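{- For every $s\ge1$, the map $\delta^{(s)}:pR\rightarrow R$ is bijective.
   Context: $p$ is an odd prime, $R$ is the $p$-adic completion of the ring of integers of the maximal unramified extension of $\mathbb Q_p$, $\phi$ is the unique Frobenius lift on $R$, and $\delta^{(s)}a\in R$ is defined for $a\in R$ by $\phi^s(a)=a^{p^s}+p\,\delta^{(s)}a$. -}

module Defs where

open import Level using (_⊔_)
open import Data.Nat as ℕ using (ℕ; zero; suc)
open import Data.Fin using (Fin; toℕ)
open import Data.Product using (Σ; ∃; _×_; _,_)
open import Relation.Nullary using (¬_)
open import Function using (_∘_)
open import Algebra.Bundles using (CommutativeRing; Semiring)
open import Algebra.Morphism.Structures using (module RingMorphisms)

module _ {c ℓ} (R : CommutativeRing c ℓ) (p : ℕ) where
  open CommutativeRing R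
  open import Algebra.Definitions.RawSemiring (Semiring.rawSemiring semiring) using (_^_; _∣_) renaming (_×_ to _·ℕ_)

  pR : Carrier
  pR = p ·ℕ 1#

  PTorsionFree : Set (c ⊔ ℓ)
  PTorsionFree = ∀ x → pR * x ≈ 0# → x ≈ 0#

  PAdicSeparated : Set (c ⊔ ℓ)
  PAdicSeparated = ∀ x → (∀ n → (pR ^ n) ∣ x) → x ≈ 0#

  PAdicComplete : Set (c ⊔ ℓ)
  PAdicComplete = ∀ (x : ℕ → Carrier) →
    (∀ n → (pR ^ n) ∣ (x (suc n) - x n)) →
    ∃ λ y → ∀ n → (pR ^ n) ∣ (y - x n)

  ResidueField : Set (c ⊔ ℓ)
  ResidueField = (¬ (pR ∣ 1#)) × (∀ x → ¬ (pR ∣ x) → ∃ λ y → pR ∣ (x * y - 1#))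

  polySum : (n : ℕ) → (Fin n → Carrier) → Carrier → Carrier
  polySum zero    cs x = 0#
  polySum (suc n) cs x = cs Fin.zero + x * polySum n (cs ∘ Fin.suc) x
    where import Data.Fin as Fin

  ResidueAlgClosed : Set (c ⊔ ℓ)
  ResidueAlgClosed = ∀ (n : ℕ) (cs : Fin (suc n) → Carrier) →
    ∃ λ x → pR ∣ (x ^ suc n + polySum (suc n) cs x)

  ResidueAlgebraicOverFp : Set (c ⊔ ℓ)
  ResidueAlgebraicOverFp = ∀ x → ∃ λ k → pR ∣ (x ^ (p ℕ.^ suc k) - x)

  -- R is (up to isomorphism) the p-adic completion of the ring of integers of
  -- the maximal unramified extension of ℚ_p, i.e. W(𝔽̄_p)
  IsCompletedMaxUnramified : Set (c ⊔ ℓ)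
  IsCompletedMaxUnramified =
    PTorsionFree × PAdicSeparated × PAdicComplete ×
    ResidueField × ResidueAlgClosed × ResidueAlgebraicOverFp

  open RingMorphisms rawRing rawRing using (IsRingHomomorphism)

  IsFrobeniusLift : (Carrier → Carrier) → Set (c ⊔ ℓ)
  IsFrobeniusLift φ = IsRingHomomorphism φ × (∀ x → pR ∣ (φ x - x ^ p))

  iter : (Carrier → Carrier) → ℕ → Carrier → Carrier
  iter φ zero    x = x
  iter φ (suc s) x = φ (iter φ s x)

  -- d = δ^(s) a, i.e. φ^s(a) = a^(p^s) + p·d  (d is unique as R has no p-torsion)
  IsDelta : (Carrier → Carrier) → ℕ → Carrier → Carrier → Set ℓ
  IsDelta φ s a d = iter φ s a ≈ a ^ (p ℕ.^ s) + pR * d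

  DeltaBijectiveOnpR : (Carrier → Carrier) → ℕ → Set (c ⊔ ℓ)
  DeltaBijectiveOnpR φ s =
    (∀ d → ∃ λ a → (pR ∣ a) × IsDelta φ s a d)
    ×
    (∀ a a′ d d′ → pR ∣ a → pR ∣ a′ → IsDelta φ s a d → IsDelta φ s a′ d′ →
       d ≈ d′ → a ≈ a′)

{-# OPTIONS --safe #-}
-- Write F = φˢ and M = pˢ. For a = p b the defining identity φˢ(a) = aᴹ + p δ⁽ˢ⁾(a)
-- becomes, after cancelling p (R has no p-torsion), δ⁽ˢ⁾(p b) = G(b) := F(b) − pᴹ⁻¹ bᴹ,
-- so it suffices that G is a bijection of R. Modulo p, F is a power of the
-- Frobenius: it is onto on residues because R/p is algebraically closed, and it detects
-- divisibility by p because R/p is algebraic over 𝔽_p, hence perfect. As M − 1 ≥ 1, the map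
-- satisfies G(x + pⁿt) ≡ G(x) + pⁿF(t) mod pⁿ⁺¹, so a solution of G(b) = d is refined one
-- p-adic digit at a time and converges by completeness. Conversely G(b) = G(b′) forces
-- F(b − b′) ∈ p(b − b′)R, which by induction puts b − b′ in every pⁿR, so b = b′.
module Submission where

open import Defs
open import Agda.Primitive using (Level)
open import Algebra.Bundles using (CommutativeRing; Semiring)
open import Algebra.Morphism.Structures using (module RingMorphisms)
import Algebra.Morphism.Construct.Composition as Composition
import Algebra.Morphism.Construct.Identity as Identity
open import Algebra.Solver.Ring.AlmostCommutativeRing using (fromCommutativeRing; _-Raw-AlmostCommutative⟶_)
open import Data.Fin using (Fin) renaming (zero to fzero; suc to fsuc)
open import Data.Integer as ℤ using (ℤ; +_; -[1+_]; _⊖_)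
import Data.Integer.Properties as ℤ
open import Data.Maybe using (Maybe; just; nothing)
open import Data.Nat as ℕ using (ℕ; zero; suc; NonZero; _%_; _≤_)
import Data.Nat.Properties as ℕ
open import Data.Nat.Primality using (Prime; prime⇒nonZero; prime⇒nonTrivial)
open import Data.Product using (Σ; ∃; _×_; _,_; proj₁; proj₂)
open import Level using (_⊔_)
open import Relation.Nullary using (yes; no)
open import Relation.Binary.PropositionalEquality as ≡ using (_≡_)

-- Integer coefficients have decidable equality, which lets the normaliser cancel
-- terms such as x − x; with R itself as coefficient ring it could not.
module IntegerCoefficientSolver {c ℓ} (R : CommutativeRing c ℓ) where
  open CommutativeRing R
  open import Algebra.Properties.Semiring.Mult semiring using (×-homo-+; ×1-homo-*) renaming (_×_ to _·ℕ_)
  open import Algebra.Properties.Ring ring using (-‿involutive; -0#≈0#; -‿distribˡ-*; -‿distribʳ-*)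
  open import Algebra.Properties.AbelianGroup +-abelianGroup using (⁻¹-∙-comm)
  open import Relation.Binary.Reasoning.Setoid setoid

  fromℤ : ℤ → Carrier
  fromℤ (+ n)    = n ·ℕ 1#
  fromℤ -[1+ n ] = - (suc n ·ℕ 1#)

  fromℤ-‿ : ∀ i → fromℤ (ℤ.- i) ≈ - fromℤ i
  fromℤ-‿ (+ zero)  = sym -0#≈0#
  fromℤ-‿ (+ suc n) = refl
  fromℤ-‿ -[1+ n ]  = sym (-‿involutive _)

  fromℤ-⊖ : ∀ m n → fromℤ (m ⊖ n) ≈ m ·ℕ 1# - n ·ℕ 1#
  fromℤ-⊖ zero    zero    = sym (-‿inverseʳ 0#)
  fromℤ-⊖ (suc m) zero    = sym (trans (+-congˡ -0#≈0#) (+-identityʳ _))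
  fromℤ-⊖ zero    (suc n) = sym (+-identityˡ _)
  fromℤ-⊖ (suc m) (suc n) = begin
    fromℤ (suc m ⊖ suc n)                       ≡⟨ ≡.cong fromℤ (ℤ.[1+m]⊖[1+n]≡m⊖n m n) ⟩
    fromℤ (m ⊖ n)                               ≈⟨ fromℤ-⊖ m n ⟩
    m ·ℕ 1# - n ·ℕ 1#                           ≈⟨ +-congʳ (sym (+-identityˡ _)) ⟩
    0# + m ·ℕ 1# - n ·ℕ 1#                      ≈⟨ +-congʳ (+-congʳ (sym (-‿inverseʳ 1#))) ⟩
    (1# - 1#) + m ·ℕ 1# - n ·ℕ 1#               ≈⟨ +-congʳ (trans (+-assoc _ _ _) (+-congˡ (+-comm _ _))) ⟩
    1# + (m ·ℕ 1# - 1#) - n ·ℕ 1#               ≈⟨ +-congʳ (sym (+-assoc _ _ _)) ⟩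
    suc m ·ℕ 1# - 1# - n ·ℕ 1#                  ≈⟨ +-assoc _ _ _ ⟩
    suc m ·ℕ 1# + (- 1# - n ·ℕ 1#)              ≈⟨ +-congˡ (⁻¹-∙-comm _ _) ⟩
    suc m ·ℕ 1# - suc n ·ℕ 1#                   ∎

  fromℤ-+ : ∀ i j → fromℤ (i ℤ.+ j) ≈ fromℤ i + fromℤ j
  fromℤ-+ (+ m)    (+ n)    = ×-homo-+ 1# m n
  fromℤ-+ (+ m)    -[1+ n ] = fromℤ-⊖ m (suc n)
  fromℤ-+ -[1+ m ] (+ n)    = trans (fromℤ-⊖ n (suc m)) (+-comm _ _)
  fromℤ-+ -[1+ m ] -[1+ n ] = begin
    - (suc (suc (m ℕ.+ n)) ·ℕ 1#)               ≡⟨ ≡.cong (λ k → - (k ·ℕ 1#)) (≡.sym (ℕ.+-suc (suc m) n)) ⟩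
    - ((suc m ℕ.+ suc n) ·ℕ 1#)                 ≈⟨ -‿cong (×-homo-+ 1# (suc m) (suc n)) ⟩
    - (suc m ·ℕ 1# + suc n ·ℕ 1#)               ≈⟨ ⁻¹-∙-comm _ _ ⟨
    - (suc m ·ℕ 1#) - suc n ·ℕ 1#               ∎

  fromℤ-* : ∀ i j → fromℤ (i ℤ.* j) ≈ fromℤ i * fromℤ j
  fromℤ-* (+ zero)  j         = trans (reflexive (≡.cong fromℤ (ℤ.*-zeroˡ j))) (sym (zeroˡ _))
  fromℤ-* -[1+ m ]  (+ zero)  = trans (reflexive (≡.cong fromℤ (ℤ.*-zeroʳ -[1+ m ]))) (sym (zeroʳ _))
  fromℤ-* (+ suc m) (+ n)     = trans (reflexive (≡.cong fromℤ (ℤ.+◃n≡+n (suc m ℕ.* n)))) (×1-homo-* (suc m) n)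
  fromℤ-* (+ suc m) -[1+ n ]  = trans (-‿cong (×1-homo-* (suc m) (suc n))) (-‿distribʳ-* _ _)
  fromℤ-* -[1+ m ]  (+ suc n) = trans (-‿cong (×1-homo-* (suc m) (suc n))) (-‿distribˡ-* _ _)
  fromℤ-* -[1+ m ]  -[1+ n ]  = begin
    (suc m ℕ.* suc n) ·ℕ 1#                     ≈⟨ ×1-homo-* (suc m) (suc n) ⟩
    suc m ·ℕ 1# * suc n ·ℕ 1#                   ≈⟨ -‿involutive _ ⟨
    - - (suc m ·ℕ 1# * suc n ·ℕ 1#)             ≈⟨ -‿cong (-‿distribˡ-* _ _) ⟩
    - (- (suc m ·ℕ 1#) * suc n ·ℕ 1#)           ≈⟨ -‿distribʳ-* _ _ ⟩
    - (suc m ·ℕ 1#) * - (suc n ·ℕ 1#)           ∎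

  fromℤ-homomorphism : ℤ.+-*-rawRing -Raw-AlmostCommutative⟶ fromCommutativeRing R
  fromℤ-homomorphism = record
    { ⟦_⟧ = fromℤ ; +-homo = fromℤ-+ ; *-homo = fromℤ-* ; -‿homo = fromℤ-‿
    ; 0-homo = refl ; 1-homo = +-identityʳ 1# }

  fromℤ-≟ : ∀ i j → Maybe (fromℤ i ≈ fromℤ j)
  fromℤ-≟ i j with i ℤ.≟ j
  ... | yes ≡.refl = just refl
  ... | no _       = nothing

  open import Algebra.Solver.Ring ℤ.+-*-rawRing (fromCommutativeRing R) fromℤ-homomorphism fromℤ-≟ public


module _ {c ℓ} (R : CommutativeRing c ℓ) where
  open CommutativeRing R
  open import Algebra.Definitions.RawSemiring (Semiring.rawSemiring semiring) using (_^_; _∣_) renaming (_×_ to _·ℕ_)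
  open import Algebra.Properties.CommutativeSemigroup.Divisibility *-commutativeSemigroup
    using (_,_; ∣ʳ-respʳ-≈; ∣ʳ-respˡ-≈; ∣ʳ-trans; x∣ʳyx; x∣ʳy⇒x∣ʳzy; x∣xy; ∙-cong-∣)
  open import Algebra.Properties.Semiring.Divisibility semiring using (_∣0; ε∣ʳ_; ∣ʳ-refl)
  open import Algebra.Properties.Semiring.Exp semiring using (^-congˡ; ^-congʳ; ^-assocʳ)
  open import Algebra.Properties.CommutativeSemiring.Exp commutativeSemiring using (^-distrib-*)
  open import Algebra.Properties.Ring ring using (-‿distribˡ-*)
  open import Algebra.Properties.Group +-group using ()
    renaming (∙-cancelˡ to +-cancelˡ; x∙y⁻¹≈ε⇒x≈y to x-y≈0⇒x≈y; x≈y⇒x∙y⁻¹≈ε to x≈y⇒x-y≈0)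
  open RingMorphisms rawRing rawRing using (IsRingHomomorphism)
  open IntegerCoefficientSolver R using (solve; _:+_; _:*_; _:-_; :-_; _:=_)
  open import Relation.Binary.Reasoning.Setoid setoid

  ∣x∣y⇒∣x+y : ∀ {d x y} → d ∣ x → d ∣ y → d ∣ x + y
  ∣x∣y⇒∣x+y {d} (q , qd≈x) (r , rd≈y) = q + r , trans (distribʳ d q r) (+-cong qd≈x rd≈y)

  ∣x⇒∣-x : ∀ {d x} → d ∣ x → d ∣ - x
  ∣x⇒∣-x {d} (q , qd≈x) = - q , trans (sym (-‿distribˡ-* q d)) (-‿cong qd≈x)

  ∣x∣y⇒∣x-y : ∀ {d x y} → d ∣ x → d ∣ y → d ∣ x - y
  ∣x∣y⇒∣x-y d∣x d∣y = ∣x∣y⇒∣x+y d∣x (∣x⇒∣-x d∣y)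

  ∣x-y∣y-z⇒∣x-z : ∀ {d x y z} → d ∣ x - y → d ∣ y - z → d ∣ x - z
  ∣x-y∣y-z⇒∣x-z {x = x} {y} {z} d∣x-y d∣y-z = ∣ʳ-respʳ-≈
    (solve 3 (λ x y z → (x :- y) :+ (y :- z) := x :- z) refl x y z) (∣x∣y⇒∣x+y d∣x-y d∣y-z)

  ∣x∣x-y⇒∣y : ∀ {d x y} → d ∣ x → d ∣ x - y → d ∣ y
  ∣x∣x-y⇒∣y {x = x} {y} d∣x d∣x-y = ∣ʳ-respʳ-≈
    (solve 2 (λ x y → x :- (x :- y) := y) refl x y) (∣x∣y⇒∣x-y d∣x d∣x-y)

  x-y∣xⁿ-yⁿ : ∀ x y n → x - y ∣ x ^ n - y ^ n
  x-y∣xⁿ-yⁿ x y zero    = ∣ʳ-respʳ-≈ (sym (-‿inverseʳ 1#)) (_ ∣0)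
  x-y∣xⁿ-yⁿ x y (suc n) = ∣ʳ-respʳ-≈ telescope
    (∣x∣y⇒∣x+y (x∣ʳy⇒x∣ʳzy x (x-y∣xⁿ-yⁿ x y n)) (x∣xy (x - y) (y ^ n)))
    where
    telescope : x * (x ^ n - y ^ n) + (x - y) * y ^ n ≈ x ^ suc n - y ^ suc n
    telescope = solve 4 (λ x y xⁿ yⁿ → x :* (xⁿ :- yⁿ) :+ (x :- y) :* yⁿ := x :* xⁿ :- y :* yⁿ)
                        refl x y (x ^ n) (y ^ n)

  module RingEndomorphism {f : Carrier → Carrier} (f-hom : IsRingHomomorphism f) where
    open IsRingHomomorphism f-hom

    homo-- : ∀ x y → f (x - y) ≈ f x - f y
    homo-- x y = trans (+-homo x (- y)) (+-congˡ (-‿homo y))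

    homo-·ℕ1 : ∀ n → f (n ·ℕ 1#) ≈ n ·ℕ 1#
    homo-·ℕ1 zero    = 0#-homo
    homo-·ℕ1 (suc n) = trans (+-homo 1# (n ·ℕ 1#)) (+-cong 1#-homo (homo-·ℕ1 n))

    homo-^ : ∀ x n → f (x ^ n) ≈ f x ^ n
    homo-^ x zero    = 1#-homo
    homo-^ x (suc n) = trans (*-homo x (x ^ n)) (*-congˡ (homo-^ x n))

    homo-∣ : ∀ {d x} → f d ≈ d → d ∣ x → d ∣ f x
    homo-∣ {d} fd≈d (q , qd≈x) = f q , trans (*-congˡ (sym fd≈d)) (trans (sym (*-homo q d)) (⟦⟧-cong qd≈x))

  module _ (p : ℕ) where
    π : Carrier
    π = pR R p

    SurjectiveModπ : (Carrier → Carrier) → Set (c ⊔ ℓ)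
    SurjectiveModπ f = ∀ e → ∃ λ t → π ∣ f t - e

    Reflectsπ∣ : (Carrier → Carrier) → Set (c ⊔ ℓ)
    Reflectsπ∣ f = ∀ x → π ∣ f x → π ∣ x

    π-fixed : ∀ {f} → IsRingHomomorphism f → f π ≈ π
    π-fixed f-hom = RingEndomorphism.homo-·ℕ1 f-hom p

    π^-fixed : ∀ {f} → IsRingHomomorphism f → ∀ n → f (π ^ n) ≈ π ^ n
    π^-fixed f-hom n = trans (RingEndomorphism.homo-^ f-hom π n) (^-congˡ n (π-fixed f-hom))

    iter-isRingHomomorphism : ∀ {φ} → IsRingHomomorphism φ → ∀ s → IsRingHomomorphism (iter R p φ s)
    iter-isRingHomomorphism φ-hom zero    = Identity.isRingHomomorphism rawRing refl
    iter-isRingHomomorphism φ-hom (suc s) =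
      Composition.isRingHomomorphism trans (iter-isRingHomomorphism φ-hom s) φ-hom

    iter-surjectiveModπ : ∀ {φ} → IsRingHomomorphism φ → SurjectiveModπ φ → ∀ s → SurjectiveModπ (iter R p φ s)
    iter-surjectiveModπ φ-hom φ-surj zero    e = e , ∣ʳ-respʳ-≈ (sym (-‿inverseʳ e)) (π ∣0)
    iter-surjectiveModπ {φ} φ-hom φ-surj (suc s) e =
      let u , π∣φu-e = φ-surj e
          t , π∣φˢt-u = iter-surjectiveModπ φ-hom φ-surj s u
      in t , ∣x-y∣y-z⇒∣x-z (∣ʳ-respʳ-≈ (homo-- _ u) (homo-∣ (π-fixed φ-hom) π∣φˢt-u)) π∣φu-e
      where open RingEndomorphism φ-hom

    iter-reflectsπ∣ : ∀ {φ} → Reflectsπ∣ φ → ∀ s → Reflectsπ∣ (iter R p φ s)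
    iter-reflectsπ∣ φ-refl zero    x π∣x   = π∣x
    iter-reflectsπ∣ φ-refl (suc s) x π∣φˢ⁺¹x = iter-reflectsπ∣ φ-refl s x (φ-refl _ π∣φˢ⁺¹x)

    polySum-zero : ∀ n (cs : Fin n → Carrier) x → (∀ i → cs i ≈ 0#) → polySum R p n cs x ≈ 0#
    polySum-zero zero    cs x cs≈0 = refl
    polySum-zero (suc n) cs x cs≈0 = begin
      cs fzero + x * polySum R p n (λ i → cs (fsuc i)) x
        ≈⟨ +-cong (cs≈0 fzero) (*-congˡ (polySum-zero n _ x (λ i → cs≈0 (fsuc i)))) ⟩
      0# + x * 0#
        ≈⟨ trans (+-identityˡ _) (zeroʳ x) ⟩
      0# ∎

    residue-root : ResidueAlgClosed R p → ∀ n e → ∃ λ t → π ∣ t ^ suc n - e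
    residue-root alg-closed n e =
      let t , π∣tⁿ⁺¹+f[t] = alg-closed n coefficients in t , ∣ʳ-respʳ-≈ (+-congˡ (polySum≈-e t)) π∣tⁿ⁺¹+f[t]
      where
      coefficients : Fin (suc n) → Carrier
      coefficients fzero    = - e
      coefficients (fsuc _) = 0#
      polySum≈-e : ∀ t → polySum R p (suc n) coefficients t ≈ - e
      polySum≈-e t = trans (+-congˡ (trans (*-congˡ (polySum-zero n _ t (λ _ → refl))) (zeroʳ t))) (+-identityʳ _)

    ∣xᵖ⇒∣x : .{{NonZero p}} → ResidueAlgebraicOverFp R p → ∀ x → π ∣ x ^ p → π ∣ x
    ∣xᵖ⇒∣x algebraic x π∣xᵖ = let k , π∣xᴺ-x = algebraic x in ∣x∣x-y⇒∣y (π∣xᴺ k) π∣xᴺ-x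
      where
      π∣xᴺ : ∀ k → π ∣ x ^ (p ℕ.^ suc k)
      π∣xᴺ k = ∣ʳ-respʳ-≈ xᴺ≈[xᵖ]^[1+m] (∣ʳ-trans π∣xᵖ (x∣xy (x ^ p) ((x ^ p) ^ m)))
        where
        instance
          pᵏ≢0 : NonZero (p ℕ.^ k)
          pᵏ≢0 = ℕ.m^n≢0 p k
        m : ℕ
        m = ℕ.pred (p ℕ.^ k)
        xᴺ≈[xᵖ]^[1+m] : (x ^ p) ^ suc m ≈ x ^ (p ℕ.^ suc k)
        xᴺ≈[xᵖ]^[1+m] = trans (^-congʳ (x ^ p) (ℕ.suc-pred (p ℕ.^ k))) (^-assocʳ x p (p ℕ.^ k))

    module FrobeniusLift {φ} (φ-lift : IsFrobeniusLift R p φ) where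
      π∣φx-xᵖ : ∀ x → π ∣ φ x - x ^ p
      π∣φx-xᵖ = proj₂ φ-lift

      φ-surjectiveModπ : .{{NonZero p}} → ResidueAlgClosed R p → SurjectiveModπ φ
      φ-surjectiveModπ alg-closed e =
        let t , π∣tᵖ-e = residue-root alg-closed (ℕ.pred p) e
        in t , ∣x-y∣y-z⇒∣x-z (π∣φx-xᵖ t) (∣ʳ-respʳ-≈ (+-congʳ (^-congʳ t (ℕ.suc-pred p))) π∣tᵖ-e)

      φ-reflectsπ∣ : .{{NonZero p}} → ResidueAlgebraicOverFp R p → Reflectsπ∣ φ
      φ-reflectsπ∣ algebraic x π∣φx = ∣xᵖ⇒∣x algebraic x (∣x∣x-y⇒∣y π∣φx (π∣φx-xᵖ x))

    successive-approximation : PAdicSeparated R p → PAdicComplete R p →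
      ∀ (H L : Carrier → Carrier) → SurjectiveModπ L →
      (∀ n x t → π ^ suc n ∣ H (x + π ^ n * t) - H x - π ^ n * L t) →
      (∀ n x y → π ^ n ∣ x - y → π ^ n ∣ H x - H y) →
      ∀ d → ∃ λ y → H y ≈ d
    successive-approximation separated complete H L L-surj H-linear H-cong d =
      y , x-y≈0⇒x≈y (H y) d (separated (H y - d) π^n∣Hy-d)
      where
      Approximant : ℕ → Set (c ⊔ ℓ)
      Approximant n = Σ Carrier λ x → π ^ n ∣ H x - d

      refine : ∀ n → Approximant n → Approximant (suc n)
      refine n (x , (e , eπⁿ≈Hx-d)) = x + π ^ n * t , ∣ʳ-respʳ-≈ (sym split)
          (∣x∣y⇒∣x+y (∣x∣y⇒∣x+y (H-linear n x t) (∙-cong-∣ π∣Lt+e ∣ʳ-refl))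
                     (∣ʳ-respʳ-≈ (sym remainder≈0) (_ ∣0)))
        where
        t : Carrier
        t = proj₁ (L-surj (- e))
        π∣Lt+e : π ∣ L t - - e
        π∣Lt+e = proj₂ (L-surj (- e))
        split : H (x + π ^ n * t) - d ≈ (H (x + π ^ n * t) - H x - π ^ n * L t) + (L t - - e) * π ^ n + ((H x - d) - e * π ^ n)
        split = solve 6 (λ Hx′ Hx Q Lt d e → Hx′ :- d := (Hx′ :- Hx :- Q :* Lt) :+ (Lt :- :- e) :* Q :+ ((Hx :- d) :- e :* Q))
                        refl (H (x + π ^ n * t)) (H x) (π ^ n) (L t) d e
        remainder≈0 : (H x - d) - e * π ^ n ≈ 0#
        remainder≈0 = x≈y⇒x-y≈0 (sym eπⁿ≈Hx-d)

      approximant : ∀ n → Approximant n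
      approximant zero    = 0# , ε∣ʳ _
      approximant (suc n) = refine n (approximant n)

      xs : ℕ → Carrier
      xs n = proj₁ (approximant n)

      cauchy : ∀ n → π ^ n ∣ xs (suc n) - xs n
      cauchy n = ∣ʳ-respʳ-≈ (solve 3 (λ x Q t → Q :* t := x :+ Q :* t :- x) refl (xs n) (π ^ n) _) (x∣xy (π ^ n) _)

      y : Carrier
      y = proj₁ (complete xs cauchy)

      π^n∣Hy-d : ∀ n → π ^ n ∣ H y - d
      π^n∣Hy-d n = ∣x-y∣y-z⇒∣x-z (H-cong n y (xs n) (proj₂ (complete xs cauchy) n)) (proj₂ (approximant n))

    *π-cancelʳ : PTorsionFree R p → ∀ {x y} → x * π ≈ y * π → x ≈ y
    *π-cancelʳ torsion-free {x} {y} xπ≈yπ = x-y≈0⇒x≈y x y (torsion-free (x - y) (begin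
      π * (x - y)   ≈⟨ solve 3 (λ q x y → q :* (x :- y) := x :* q :- y :* q) refl π x y ⟩
      x * π - y * π ≈⟨ x≈y⇒x-y≈0 xπ≈yπ ⟩
      0#            ∎))

    *πⁿ-cancelʳ : PTorsionFree R p → ∀ n {x y} → x * π ^ n ≈ y * π ^ n → x ≈ y
    *πⁿ-cancelʳ torsion-free zero    {x} {y} x≈y = trans (sym (*-identityʳ x)) (trans x≈y (*-identityʳ y))
    *πⁿ-cancelʳ torsion-free (suc n) xππⁿ≈yππⁿ = *π-cancelʳ torsion-free
      (*πⁿ-cancelʳ torsion-free n (trans (*-assoc _ π _) (trans xππⁿ≈yππⁿ (sym (*-assoc _ π _)))))

    module _ {F : Carrier → Carrier} (F-hom : IsRingHomomorphism F) where
      open RingEndomorphism F-hom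
      open IsRingHomomorphism F-hom using (⟦⟧-cong; +-homo; *-homo)

      Fx≈πcx⇒x≈0 : PTorsionFree R p → PAdicSeparated R p → Reflectsπ∣ F → ∀ x c → F x ≈ π * c * x → x ≈ 0#
      Fx≈πcx⇒x≈0 torsion-free separated F-refl x c Fx≈πcx = separated x π^n∣x
        where
        π^n∣x : ∀ n → π ^ n ∣ x
        π^n∣x zero = ε∣ʳ x
        π^n∣x (suc n) with π^n∣x n
        ... | z , zπⁿ≈x = ∣ʳ-respʳ-≈ zπⁿ≈x (∙-cong-∣ π∣z ∣ʳ-refl)
          where
          Fz≈πcz : F z ≈ π * c * z
          Fz≈πcz = *πⁿ-cancelʳ torsion-free n (begin
            F z * π ^ n         ≈⟨ *-congˡ (π^-fixed F-hom n) ⟨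
            F z * F (π ^ n)     ≈⟨ *-homo z (π ^ n) ⟨
            F (z * π ^ n)       ≈⟨ ⟦⟧-cong zπⁿ≈x ⟩
            F x                 ≈⟨ Fx≈πcx ⟩
            π * c * x           ≈⟨ *-congˡ zπⁿ≈x ⟨
            π * c * (z * π ^ n) ≈⟨ *-assoc _ z _ ⟨
            π * c * z * π ^ n   ∎)
          π∣z : π ∣ z
          π∣z = F-refl z (∣ʳ-respʳ-≈ (sym Fz≈πcz) (∣ʳ-trans (x∣xy π c) (x∣xy (π * c) z)))

      -- For F = φˢ and M = pˢ = K + 2, δπ b is δ⁽ˢ⁾(p b): see IsDelta⇒δπ≈.
      module _ (K M : ℕ) where
        δπ : Carrier → Carrier
        δπ b = F b - π ^ suc K * b ^ M

        δπ-linear : ∀ n x t → π ^ suc n ∣ δπ (x + π ^ n * t) - δπ x - π ^ n * F t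
        δπ-linear n x t = ∣ʳ-respʳ-≈ (sym split) (∣x⇒∣-x (∙-cong-∣ (x∣xy π (π ^ K)) πⁿ∣[x+πⁿt]ᴹ-xᴹ))
          where
          F[x+πⁿt]≈Fx+πⁿFt : F (x + π ^ n * t) ≈ F x + π ^ n * F t
          F[x+πⁿt]≈Fx+πⁿFt = trans (+-homo x _) (+-congˡ (trans (*-homo (π ^ n) t) (*-congʳ (π^-fixed F-hom n))))
          πⁿ∣[x+πⁿt]ᴹ-xᴹ : π ^ n ∣ (x + π ^ n * t) ^ M - x ^ M
          πⁿ∣[x+πⁿt]ᴹ-xᴹ = ∣ʳ-trans (x∣xy (π ^ n) t)
            (∣ʳ-respˡ-≈ (solve 3 (λ x Q t → x :+ Q :* t :- x := Q :* t) refl x (π ^ n) t) (x-y∣xⁿ-yⁿ _ x M))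
          split : δπ (x + π ^ n * t) - δπ x - π ^ n * F t ≈ - (π ^ suc K * ((x + π ^ n * t) ^ M - x ^ M))
          split = begin
            F (x + π ^ n * t) - π ^ suc K * (x + π ^ n * t) ^ M - δπ x - π ^ n * F t
              ≈⟨ +-congʳ (+-congʳ (+-congʳ F[x+πⁿt]≈Fx+πⁿFt)) ⟩
            F x + π ^ n * F t - π ^ suc K * (x + π ^ n * t) ^ M - δπ x - π ^ n * F t
              ≈⟨ solve 5 (λ Fx QFt k u v → Fx :+ QFt :- k :* u :- (Fx :- k :* v) :- QFt := :- (k :* (u :- v)))
                         refl (F x) (π ^ n * F t) (π ^ suc K) ((x + π ^ n * t) ^ M) (x ^ M) ⟩
            - (π ^ suc K * ((x + π ^ n * t) ^ M - x ^ M)) ∎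

        δπ-cong : ∀ n x y → π ^ n ∣ x - y → π ^ n ∣ δπ x - δπ y
        δπ-cong n x y πⁿ∣x-y = ∣ʳ-respʳ-≈ split
          (∣x∣y⇒∣x-y (∣ʳ-respʳ-≈ (homo-- x y) (homo-∣ (π^-fixed F-hom n) πⁿ∣x-y))
                     (x∣ʳy⇒x∣ʳzy (π ^ suc K) (∣ʳ-trans πⁿ∣x-y (x-y∣xⁿ-yⁿ x y M))))
          where
          split : F x - F y - π ^ suc K * (x ^ M - y ^ M) ≈ δπ x - δπ y
          split = solve 5 (λ Fx Fy k u v → Fx :- Fy :- k :* (u :- v) := Fx :- k :* u :- (Fy :- k :* v))
                          refl (F x) (F y) (π ^ suc K) (x ^ M) (y ^ M)

        δπ-surjective : PAdicSeparated R p → PAdicComplete R p → SurjectiveModπ F → ∀ d → ∃ λ b → δπ b ≈ d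
        δπ-surjective separated complete F-surj =
          successive-approximation separated complete δπ F F-surj δπ-linear δπ-cong

        δπ-injective : PTorsionFree R p → PAdicSeparated R p → Reflectsπ∣ F → ∀ {b b′} → δπ b ≈ δπ b′ → b ≈ b′
        δπ-injective torsion-free separated F-refl {b} {b′} δπb≈δπb′ with x-y∣xⁿ-yⁿ b b′ M
        ... | w , w[b-b′]≈bᴹ-b′ᴹ = x-y≈0⇒x≈y b b′ (Fx≈πcx⇒x≈0 torsion-free separated F-refl (b - b′) (π ^ K * w) (begin
          F (b - b′)                                    ≈⟨ homo-- b b′ ⟩
          F b - F b′                                    ≈⟨ solve 5 (λ Fb Fb′ k u v → Fb :- Fb′ := (Fb :- k :* u :- (Fb′ :- k :* v)) :+ k :* (u :- v))
                                                                   refl (F b) (F b′) (π ^ suc K) (b ^ M) (b′ ^ M) ⟩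
          δπ b - δπ b′ + π ^ suc K * (b ^ M - b′ ^ M)   ≈⟨ +-congʳ (x≈y⇒x-y≈0 δπb≈δπb′) ⟩
          0# + π ^ suc K * (b ^ M - b′ ^ M)             ≈⟨ +-identityˡ _ ⟩
          π ^ suc K * (b ^ M - b′ ^ M)                  ≈⟨ *-congˡ w[b-b′]≈bᴹ-b′ᴹ ⟨
          π ^ suc K * (w * (b - b′))                    ≈⟨ solve 4 (λ q qᴷ w x → q :* qᴷ :* (w :* x) := q :* (qᴷ :* w) :* x)
                                                                   refl π (π ^ K) w (b - b′) ⟩
          π * (π ^ K * w) * (b - b′)                    ∎))

    module _ {φ : Carrier → Carrier} (φ-hom : IsRingHomomorphism φ) (s K : ℕ) (pˢ≡2+K : p ℕ.^ s ≡ 2 ℕ.+ K) where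
      private
        F : Carrier → Carrier
        F = iter R p φ s
        F-hom : IsRingHomomorphism F
        F-hom = iter-isRingHomomorphism φ-hom s
        M : ℕ
        M = p ℕ.^ s
      open IsRingHomomorphism F-hom using (⟦⟧-cong; *-homo)

      F[bπ]≈[bπ]ᴹ+πδπb : ∀ b → F (b * π) ≈ (b * π) ^ M + π * δπ F-hom K M b
      F[bπ]≈[bπ]ᴹ+πδπb b = begin
        F (b * π)                           ≈⟨ trans (*-homo b π) (*-congˡ (π-fixed F-hom)) ⟩
        F b * π                             ≈⟨ solve 4 (λ Fb q k bᴹ → Fb :* q := bᴹ :* (q :* k) :+ q :* (Fb :- k :* bᴹ))
                                                       refl (F b) π (π ^ suc K) (b ^ M) ⟩
        b ^ M * π ^ (2 ℕ.+ K) + π * δπ F-hom K M b ≈⟨ +-congʳ (*-congˡ (^-congʳ π pˢ≡2+K)) ⟨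
        b ^ M * π ^ M + π * δπ F-hom K M b  ≈⟨ +-congʳ (^-distrib-* b π M) ⟨
        (b * π) ^ M + π * δπ F-hom K M b    ∎

      δπ≈⇒IsDelta : ∀ {b d} → δπ F-hom K M b ≈ d → IsDelta R p φ s (b * π) d
      δπ≈⇒IsDelta {b} δπb≈d = trans (F[bπ]≈[bπ]ᴹ+πδπb b) (+-congˡ (*-congˡ δπb≈d))

      IsDelta⇒δπ≈ : PTorsionFree R p → ∀ {b d} → IsDelta R p φ s (b * π) d → δπ F-hom K M b ≈ d
      IsDelta⇒δπ≈ torsion-free {b} {d} δ = *π-cancelʳ torsion-free
        (trans (*-comm _ π) (trans (+-cancelˡ ((b * π) ^ M) _ _ (trans (sym (F[bπ]≈[bπ]ᴹ+πδπb b)) δ)) (*-comm π d)))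

      IsDelta-respˡ : ∀ {a a′ d} → a ≈ a′ → IsDelta R p φ s a d → IsDelta R p φ s a′ d
      IsDelta-respˡ a≈a′ δ = trans (⟦⟧-cong (sym a≈a′)) (trans δ (+-congʳ (^-congˡ M a≈a′)))

      deltaBijective : PTorsionFree R p → PAdicSeparated R p → PAdicComplete R p →
                       SurjectiveModπ φ → Reflectsπ∣ φ → DeltaBijectiveOnpR R p φ s
      deltaBijective torsion-free separated complete φ-surj φ-refl = surjective , injective
        where
        surjective : ∀ d → ∃ λ a → π ∣ a × IsDelta R p φ s a d
        surjective d = b * π , x∣ʳyx π b , δπ≈⇒IsDelta δπb≈d
          where
          solution : ∃ λ b → δπ F-hom K M b ≈ d
          solution = δπ-surjective F-hom K M separated complete (iter-surjectiveModπ φ-hom φ-surj s) d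
          b : Carrier
          b = proj₁ solution
          δπb≈d : δπ F-hom K M b ≈ d
          δπb≈d = proj₂ solution

        injective : ∀ a a′ d d′ → π ∣ a → π ∣ a′ → IsDelta R p φ s a d → IsDelta R p φ s a′ d′ → d ≈ d′ → a ≈ a′
        injective a a′ d d′ (b , bπ≈a) (b′ , b′π≈a′) δ δ′ d≈d′ = begin
          a      ≈⟨ bπ≈a ⟨
          b * π  ≈⟨ *-congʳ b≈b′ ⟩
          b′ * π ≈⟨ b′π≈a′ ⟩
          a′     ∎
          where
          δπ≈ : ∀ {a b d} → b * π ≈ a → IsDelta R p φ s a d → δπ F-hom K M b ≈ d
          δπ≈ bπ≈a δ = IsDelta⇒δπ≈ torsion-free (IsDelta-respˡ (sym bπ≈a) δ)
          b≈b′ : b ≈ b′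
          b≈b′ = δπ-injective F-hom K M torsion-free separated (iter-reflectsπ∣ φ-refl s)
                   (trans (δπ≈ bπ≈a δ) (trans d≈d′ (sym (δπ≈ b′π≈a′ δ′))))

corollary2p21 : ∀ {c ℓ : Level} (p : ℕ) → Prime p → p % 2 ≡ 1 →
    (R : CommutativeRing c ℓ) → IsCompletedMaxUnramified R p →
    (φ : CommutativeRing.Carrier R → CommutativeRing.Carrier R) → IsFrobeniusLift R p φ →
    (s : ℕ) → 1 ≤ s → DeltaBijectiveOnpR R p φ s
corollary2p21 p p-prime _ R (torsion-free , separated , complete , _ , alg-closed , algebraic) φ φ-lift s 1≤s =
  deltaBijective R p (proj₁ φ-lift) s K pˢ≡2+K torsion-free separated complete
    (φ-surjectiveModπ alg-closed) (φ-reflectsπ∣ algebraic)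
  where
  instance
    p≢0 : NonZero p
    p≢0 = prime⇒nonZero p-prime
  open FrobeniusLift R p φ-lift
  2≤pˢ : 2 ≤ p ℕ.^ s
  2≤pˢ = ℕ.≤-trans (ℕ.nonTrivial⇒n>1 p {{prime⇒nonTrivial p-prime}})
                   (≡.subst (_≤ p ℕ.^ s) (ℕ.*-identityʳ p) (ℕ.^-monoʳ-≤ p 1≤s))
  K : ℕ
  K = proj₁ (ℕ.m≤n⇒∃[o]m+o≡n 2≤pˢ)
  pˢ≡2+K : p ℕ.^ s ≡ 2 ℕ.+ K
  pˢ≡2+K = ≡.sym (proj₂ (ℕ.m≤n⇒∃[o]m+o≡n 2≤pˢ))
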